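{- (a) Let $(\widetilde{W},\widetilde{\omega}_W)$ be a lift of a directed walk $(W,\omega_W)$. If $W$ is closed and has positive sign, then $(\widetilde{W},\widetilde{\omega}_W)$ is a directed closed walk, and $\pi\big(f_{(\widetilde{W},\,\widetilde{\omega}_W)}\big)=f_{(W,\,\omega_W)}$. (b) Let $f$ be an integral flow on $(\Sigma,\omega)$ such that $f=f_{(W,\,\omega_f)}$, where $(W,\omega_f)$ is a directed closed positive walk. If $(W,\omega_f)$ is lifted to a directed closed walk $(\widetilde{W},\widetilde{\omega}_f)$ in $\widetilde\Sigma$, then $f_{(\widetilde{W},\,\widetilde{\omega}_f)}$ is a flow on $(\widetilde\Sigma,\widetilde\omega)$ lifted from $f$. Moreover, if $f\geq 0$, then $f_{(\widetilde{W},\,\widetilde{\omega}_f)}\geq 0$.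
   Context: $\Sigma=(G,\sigma)$ is a signed graph with orientation $\omega$ (a $\pm1$ value on each edge end with $\sigma(e)=-\omega(u,e)\omega(v,e)$). A walk $W=v_0e_1v_1\cdots e_nv_n$ has sign $\prod\sigma(e_i)$; a direction $\omega_W$ orients its edges coherently at internal vertices (and at $v_0=v_n$ for a directed closed walk). For a directed walk, $f_{(W,\omega_W)}(e)=\sum_{e_i=e}[\omega,\omega_W](e_i)$, where $[\omega_1,\omega_2](e)=\omega_1(v,e)\omega_2(v,e)$. An integral flow is $f:E\to\mathbb Z$ with $\sum_{\text{ends }(v,e)}\omega(v,e)f(e)=0$ at each vertex $v$. $\omega_f$ is the orientation equal to $\omega$ where $f(e)\ge0$ and $-\omega$ where $f(e)<0$. The double covering graph $\widetilde\Sigma$ has vertices $v^{\pm}$ and, for each edge $e$ joining $u,v$, two edges $\tilde e,\tilde e^*$ joining $u^\alpha$ to $v^{\alpha\sigma(e)}$ for $\alpha=\pm$; the lifted orientation is $\widetilde\omega(v^\alpha,e^\beta)=\alpha\,\omega(v,e)$, and likewise directions lift. A lift of $W$ is $\widetilde W=v_0^{\alpha_0}\tilde e_1v_1^{\alpha_1}\cdots\tilde e_nv_n^{\alpha_n}$ with $\alpha_i=\alpha_{i-1}\sigma(e_i)$, and $\widetilde\omega_W$ is the lift of $\omega_W$. For $\tilde f:E(\widetilde\Sigma)\to\mathbb Z$, $\pi(\tilde f)(e)=\tilde f(\tilde e)+\tilde f(\tilde e^*)$; a lift of a flow $f$ is a flow $\tilde f$ on $(\widetilde\Sigma,\widetilde\omega)$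 with $\pi(\tilde f)=f$. -}

module Defs where

open import Data.Nat using (ℕ) renaming (_+_ to _+ℕ_)
open import Data.Bool using (Bool; true; false; not; if_then_else_)
open import Data.Fin using (Fin; _↑ˡ_; _↑ʳ_; splitAt; _≟_)
open import Data.Sum using (_⊎_; inj₁; inj₂)
open import Data.Product using (_×_; _,_)
open import Data.Unit using (⊤)
open import Data.List using (List; []; _∷_; foldr; map; allFin)
open import Data.Sign using (Sign; opposite) renaming (_*_ to _*ˢ_; + to pos; - to neg)
open import Data.Integer using (ℤ; _+_; _*_; 0ℤ; 1ℤ; -1ℤ)
open import Relation.Binary.PropositionalEquality using (_≡_)
open import Relation.Nullary.Decidable using (⌊_⌋)

-- Signed graphs.  Vertices Fin n, edges Fin m.  Every edge e has two
-- ends, indexed by Bool; end b of e lies at vertex  endpt e b.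
-- (Loops allowed: both ends at the same vertex.)

record SignedGraph (n m : ℕ) : Set where
  field
    endpt : Fin m → Bool → Fin n
    σ     : Fin m → Sign
open SignedGraph public

sgn : Sign → ℤ
sgn pos = 1ℤ
sgn neg = -1ℤ

EndFun : ℕ → Set
EndFun m = Fin m → Bool → Sign

IsOrientation : ∀ {n m} → SignedGraph n m → EndFun m → Set
IsOrientation G ω = ∀ e → σ G e ≡ opposite (ω e false *ˢ ω e true)

sumℤ : List ℤ → ℤ
sumℤ = foldr _+_ 0ℤ

endContrib : ∀ {n m} → SignedGraph n m → EndFun m → (Fin m → ℤ) →
             Fin n → Fin m → Bool → ℤ
endContrib G ω f v e b =
  if ⌊ endpt G e b ≟ v ⌋ then sgn (ω e b) * f e else 0ℤ

netFlow : ∀ {n m} → SignedGraph n m → EndFun m → (Fin m → ℤ) → Fin n → ℤ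
netFlow {m = m} G ω f v =
  sumℤ (map (λ e → endContrib G ω f v e false + endContrib G ω f v e true)
            (allFin m))

IsFlow : ∀ {n m} → SignedGraph n m → EndFun m → (Fin m → ℤ) → Set
IsFlow G ω f = ∀ v → netFlow G ω f v ≡ 0ℤ

ωOf : ∀ {m} → EndFun m → (Fin m → ℤ) → EndFun m
ωOf ω f e b with f e
... | ℤ.pos _    = ω e b
... | ℤ.negsuc _ = opposite (ω e b)

-- A directed walk  W = v₀ e₁ v₁ ⋯ eₖ vₖ  with direction ω_W is given by
-- its initial vertex v₀ and a list of directed steps.  Step i records
-- the edge eᵢ, which end of eᵢ is at v_{i-1} (the "entry" end; the
-- other end is at vᵢ), and the values of ω_W at the two ends of this
-- occurrence of eᵢ: ωin = ω_W(v_{i-1},eᵢ), ωout = ω_W(vᵢ,eᵢ).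

record DStep (m : ℕ) : Set where
  constructor dstep
  field
    edge  : Fin m
    entry : Bool
    ωin   : Sign
    ωout  : Sign
open DStep public

record DWalk (n m : ℕ) : Set where
  constructor dwalk
  field
    start : Fin n
    steps : List (DStep m)
open DWalk public

module _ {n m : ℕ} (G : SignedGraph n m) where

  finishFrom : Fin n → List (DStep m) → Fin n
  finishFrom v []       = v
  finishFrom v (s ∷ ss) = finishFrom (endpt G (edge s) (not (entry s))) ss

  finish : DWalk n m → Fin n
  finish W = finishFrom (start W) (steps W)

  CoherentNext : DStep m → List (DStep m) → Set
  CoherentNext s []        = ⊤
  CoherentNext s (s' ∷ _)  = ωout s ≡ opposite (ωin s')

  IsDWalkFrom : Fin n → List (DStep m) → Set
  IsDWalkFrom v []       = ⊤
  IsDWalkFrom v (s ∷ ss) =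
    endpt G (edge s) (entry s) ≡ v
    × σ G (edge s) ≡ opposite (ωin s *ˢ ωout s)
    × CoherentNext s ss
    × IsDWalkFrom (endpt G (edge s) (not (entry s))) ss

  IsDirectedWalk : DWalk n m → Set
  IsDirectedWalk W = IsDWalkFrom (start W) (steps W)

  lastStep : DStep m → List (DStep m) → DStep m
  lastStep s []        = s
  lastStep s (s' ∷ ss) = lastStep s' ss

  CoherentAtStart : List (DStep m) → Set
  CoherentAtStart []       = ⊤
  CoherentAtStart (s ∷ ss) = ωout (lastStep s ss) ≡ opposite (ωin s)

  IsDirectedClosedWalk : DWalk n m → Set
  IsDirectedClosedWalk W =
    IsDirectedWalk W × finish W ≡ start W × CoherentAtStart (steps W)

  walkSign : DWalk n m → Sign
  walkSign W = foldr (λ s acc → σ G (edge s) *ˢ acc) pos (steps W)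

-- the direction of W viewed as assigning ends: direction equals ω'
-- (used for "(W, ω_f)": the direction of W is the orientation ω_f)
DirectionIs : ∀ {n m} → DWalk n m → EndFun m → Set
DirectionIs W ω' = AllSteps (steps W)
  where
  AllSteps : List (DStep _) → Set
  AllSteps []       = ⊤
  AllSteps (s ∷ ss) = ωin s ≡ ω' (edge s) (entry s)
                      × ωout s ≡ ω' (edge s) (not (entry s))
                      × AllSteps ss

fW : ∀ {n m} → EndFun m → DWalk n m → Fin m → ℤ
fW ω W e = sumℤ (map term (steps W))
  where
  term : DStep _ → ℤ
  term s = if ⌊ edge s ≟ e ⌋ then sgn (ω (edge s) (entry s) *ˢ ωin s) else 0ℤ

-- Vertices Fin (n + n):  v⁺ = v ↑ˡ n ,  v⁻ = n ↑ʳ v .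
-- Edges Fin (m + m):     ẽ = e ↑ˡ m (β = +) ,  ẽ* = m ↑ʳ e (β = -) .
-- For e with end false at u and end true at v, the copy e^β joins
-- u^β to v^{β σ(e)}; i.e. end b of e^β lies at (endpt e b)^{β · s_b}
-- where s_false = + and s_true = σ(e).

liftV : ∀ {n} → Fin n → Sign → Fin (n +ℕ n)
liftV {n} v pos = v ↑ˡ n
liftV {n} v neg = n ↑ʳ v

liftE : ∀ {m} → Fin m → Sign → Fin (m +ℕ m)
liftE {m} e pos = e ↑ˡ m
liftE {m} e neg = m ↑ʳ e

endShift : ∀ {n m} → SignedGraph n m → Fin m → Bool → Sign
endShift G e false = pos
endShift G e true  = σ G e

unliftE : ∀ {m} → Fin (m +ℕ m) → (Fin m × Sign)
unliftE {m} x with splitAt m x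
... | inj₁ e = e , pos
... | inj₂ e = e , neg

doubleCover : ∀ {n m} → SignedGraph n m → SignedGraph (n +ℕ n) (m +ℕ m)
doubleCover G = record
  { endpt = λ x b → let (e , β) = unliftE x in
                    liftV (endpt G e b) (β *ˢ endShift G e b)
  ; σ     = λ _ → pos
  }

-- lifted orientation  ω̃(v^α, e^β) = α ω(v,e)
liftOrientation : ∀ {n m} → SignedGraph n m → EndFun m → EndFun (m +ℕ m)
liftOrientation G ω x b =
  let (e , β) = unliftE x in (β *ˢ endShift G e b) *ˢ ω e b

π : ∀ {m} → (Fin (m +ℕ m) → ℤ) → Fin m → ℤ
π {m} f e = f (e ↑ˡ m) + f (m ↑ʳ e)

-- Lift of a directed walk starting on sheet α₀:
-- W̃ = v₀^{α₀} ẽ₁ v₁^{α₁} ⋯ with αᵢ = α_{i-1} σ(eᵢ), ẽᵢ the copy of eᵢ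
-- joining v_{i-1}^{α_{i-1}} to vᵢ^{αᵢ}, and lifted direction
-- ω̃_W(vᵢ^{α}, ẽ) = α ω_W(vᵢ, e).
liftSteps : ∀ {n m} → SignedGraph n m → Sign → List (DStep m) →
            List (DStep (m +ℕ m))
liftSteps G α [] = []
liftSteps G α (dstep e b wi wo ∷ ss) =
  let α' = α *ˢ σ G e in
  dstep (liftE e (α *ˢ endShift G e b)) b (α *ˢ wi) (α' *ˢ wo)
    ∷ liftSteps G α' ss

liftWalk : ∀ {n m} → SignedGraph n m → Sign → DWalk n m → DWalk (n +ℕ n) (m +ℕ m)
liftWalk G α W = dwalk (liftV (start W) α) (liftSteps G α (steps W))

-- A step of a directed walk contributes the sign of its direction at each of its two
-- ends to the net flow, because ω and the direction orient the same edge; coherence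
-- makes the contributions of consecutive steps cancel, so the function of any directed
-- closed walk is a flow.  Applied in the double cover, which carries the lifted
-- orientation, this gives (b).  A lift multiplies ω and the direction at a vertex by
-- the sheet of that vertex, which squares away in [ω̃, ω̃_W], so each lifted step has
-- the weight of its step and π recovers f_W; a positive closed walk returns to its
-- starting sheet, so its lift is closed.  If f ≥ 0 then ω_f = ω and every weight is 1.
module Submission where

open import Defs
open import Data.Fin using (Fin)
open import Data.Product using (_×_)
open import Data.Sign using (Sign; +)
open import Data.Integer using (ℤ; _≤_; 0ℤ)
open import Relation.Binary.PropositionalEquality using (_≡_)

import Algebra.Properties.CommutativeSemigroup as CommutativeSemigroupProperties
open import Data.Bool using (Bool; true; false; not; if_then_else_)
open import Data.Fin using (_≟_; zero; suc; _↑ˡ_; _↑ʳ_)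
open import Data.Fin.Properties using (splitAt-↑ˡ; splitAt-↑ʳ; suc-injective)
open import Data.Integer using (_*_; 1ℤ; +≤+) renaming (_+_ to _+ℤ_)
import Data.Integer.Properties as ℤ
open import Data.List using (List; []; _∷_; map; foldr; tabulate; allFin)
open import Data.List.Properties using (map-tabulate; map-cong; map-cong-local)
open import Data.List.Relation.Unary.All as All using (All; []; _∷_)
open import Data.Nat using (ℕ; z≤n) renaming (_+_ to _+ℕ_)
open import Data.Product using (_,_; proj₁; proj₂)
open import Data.Product.Properties using (,-injective)
open import Data.Sign using (-; opposite) renaming (_*_ to _*ˢ_)
import Data.Sign.Properties as Sign
open import Data.Unit using (tt)
open import Function using (_∘_)
open import Relation.Binary.PropositionalEquality
  using (refl; sym; trans; cong; cong₂; subst; _≢_; module ≡-Reasoning)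
open import Relation.Nullary using (yes; no; contradiction)
open import Relation.Nullary.Decidable using (⌊_⌋)

open ≡-Reasoning

private
  module Signᶜ = CommutativeSemigroupProperties Sign.*-commutativeSemigroup
  module ℤᶜ = CommutativeSemigroupProperties ℤ.+-commutativeSemigroup

[s*t]*t≡s : ∀ s t → (s *ˢ t) *ˢ t ≡ s
[s*t]*t≡s s t = begin
  (s *ˢ t) *ˢ t ≡⟨ Sign.*-assoc s t t ⟩
  s *ˢ (t *ˢ t) ≡⟨ cong (s *ˢ_) (Sign.s*s≡+ t) ⟩
  s *ˢ +        ≡⟨ Sign.*-identityʳ s ⟩
  s             ∎

s*[s*t]≡t : ∀ s t → s *ˢ (s *ˢ t) ≡ t
s*[s*t]≡t s t = trans (sym (Sign.*-assoc s s t)) (cong (_*ˢ t) (Sign.s*s≡+ s))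

[s*a]*[s*b]≡a*b : ∀ s a b → (s *ˢ a) *ˢ (s *ˢ b) ≡ a *ˢ b
[s*a]*[s*b]≡a*b s a b = trans (Signᶜ.interchange s a s b) (cong (_*ˢ (a *ˢ b)) (Sign.s*s≡+ s))

s*opposite[t]≡opposite[s*t] : ∀ s t → s *ˢ opposite t ≡ opposite (s *ˢ t)
s*opposite[t]≡opposite[s*t] + t = refl
s*opposite[t]≡opposite[s*t] - + = refl
s*opposite[t]≡opposite[s*t] - - = refl

a*b≡c*d⇒b*[a*c]≡d : ∀ {a b c d} → a *ˢ b ≡ c *ˢ d → b *ˢ (a *ˢ c) ≡ d
a*b≡c*d⇒b*[a*c]≡d {a} {b} {c} {d} ab≡cd = begin
  b *ˢ (a *ˢ c) ≡⟨ Signᶜ.x∙yz≈yx∙z b a c ⟩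
  (a *ˢ b) *ˢ c ≡⟨ cong (_*ˢ c) ab≡cd ⟩
  (c *ˢ d) *ˢ c ≡⟨ Signᶜ.xy∙z≈y∙zx c d c ⟩
  d *ˢ (c *ˢ c) ≡⟨ cong (d *ˢ_) (Sign.s*s≡+ c) ⟩
  d *ˢ +        ≡⟨ Sign.*-identityʳ d ⟩
  d             ∎

-- If (a , b) orients an edge of sign t, then shifting its ends to sheets s and s t
-- orients a positive edge.
lifted-orientation-positive : ∀ s {t a b} → t ≡ opposite (a *ˢ b) →
                              + ≡ opposite ((s *ˢ a) *ˢ ((s *ˢ t) *ˢ b))
lifted-orientation-positive s {t} {a} {b} t≡-ab = sym (begin
  opposite ((s *ˢ a) *ˢ ((s *ˢ t) *ˢ b)) ≡⟨ cong (λ x → opposite ((s *ˢ a) *ˢ x)) (Sign.*-assoc s t b) ⟩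
  opposite ((s *ˢ a) *ˢ (s *ˢ (t *ˢ b))) ≡⟨ cong opposite ([s*a]*[s*b]≡a*b s a (t *ˢ b)) ⟩
  opposite (a *ˢ (t *ˢ b))               ≡⟨ cong opposite (Signᶜ.x∙yz≈y∙xz a t b) ⟩
  opposite (t *ˢ (a *ˢ b))               ≡⟨ cong (λ x → opposite (x *ˢ (a *ˢ b))) t≡-ab ⟩
  opposite (opposite (a *ˢ b) *ˢ (a *ˢ b)) ≡⟨ cong opposite (Sign.opposite[s]*s≡- (a *ˢ b)) ⟩
  +                                        ∎)

sgn-* : ∀ s t → sgn (s *ˢ t) ≡ sgn s * sgn t
sgn-* + + = refl
sgn-* + - = refl
sgn-* - + = refl
sgn-* - - = refl

sgn-opposite+sgn≡0 : ∀ s → sgn (opposite s) +ℤ sgn s ≡ 0ℤ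
sgn-opposite+sgn≡0 + = refl
sgn-opposite+sgn≡0 - = refl

sumℤ-map-+ : ∀ {A : Set} (g h : A → ℤ) xs →
             sumℤ (map (λ x → g x +ℤ h x) xs) ≡ sumℤ (map g xs) +ℤ sumℤ (map h xs)
sumℤ-map-+ g h []       = refl
sumℤ-map-+ g h (x ∷ xs) = trans (cong (g x +ℤ h x +ℤ_) (sumℤ-map-+ g h xs))
                               (ℤᶜ.interchange (g x) (h x) _ _)

sumℤ-map-zero : ∀ {A : Set} (g : A → ℤ) xs → (∀ x → g x ≡ 0ℤ) → sumℤ (map g xs) ≡ 0ℤ
sumℤ-map-zero g []       g≡0 = refl
sumℤ-map-zero g (x ∷ xs) g≡0 = cong₂ _+ℤ_ (g≡0 x) (sumℤ-map-zero g xs g≡0)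

sumℤ-map-nonneg : ∀ {A : Set} {g : A → ℤ} {xs} →
                  All (λ x → 0ℤ ≤ g x) xs → 0ℤ ≤ sumℤ (map g xs)
sumℤ-map-nonneg []       = ℤ.≤-refl
sumℤ-map-nonneg (p ∷ ps) = ℤ.+-mono-≤ p (sumℤ-map-nonneg ps)

sumℤ-tabulate-single : ∀ {k} (g : Fin k → ℤ) i → (∀ j → j ≢ i → g j ≡ 0ℤ) →
                       sumℤ (tabulate g) ≡ g i
sumℤ-tabulate-single g zero    g≡0 = begin
  g zero +ℤ sumℤ (tabulate (g ∘ suc))  ≡⟨ cong (g zero +ℤ_) tail≡0 ⟩
  g zero +ℤ 0ℤ                         ≡⟨ ℤ.+-identityʳ (g zero) ⟩
  g zero                               ∎
  where
  tail≡0 : sumℤ (tabulate (g ∘ suc)) ≡ 0ℤ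
  tail≡0 = trans (cong sumℤ (sym (map-tabulate (λ j → j) (g ∘ suc))))
                 (sumℤ-map-zero (g ∘ suc) (allFin _) (λ j → g≡0 (suc j) (λ ())))
sumℤ-tabulate-single g (suc i) g≡0 =
  trans (cong₂ _+ℤ_ (g≡0 zero (λ ()))
                    (sumℤ-tabulate-single (g ∘ suc) i (λ j j≢i → g≡0 (suc j) (j≢i ∘ suc-injective))))
        (ℤ.+-identityˡ (g (suc i)))

sumℤ-allFin-single : ∀ {k} (g : Fin k → ℤ) i → (∀ j → j ≢ i → g j ≡ 0ℤ) →
                     sumℤ (map g (allFin k)) ≡ g i
sumℤ-allFin-single g i g≡0 = trans (cong sumℤ (map-tabulate (λ j → j) g)) (sumℤ-tabulate-single g i g≡0)

infix 5 _↦_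

_↦_ : ∀ {k} → Fin k → ℤ → Fin k → ℤ
(x ↦ a) y = if ⌊ x ≟ y ⌋ then a else 0ℤ

↦-same : ∀ {k} (x : Fin k) a → (x ↦ a) x ≡ a
↦-same x a with x ≟ x
... | yes _   = refl
... | no x≢x = contradiction refl x≢x

↦-other : ∀ {k} {x y : Fin k} a → x ≢ y → (x ↦ a) y ≡ 0ℤ
↦-other {x = x} {y} a x≢y with x ≟ y
... | yes x≡y = contradiction x≡y x≢y
... | no _    = refl

↦-+ : ∀ {k} (x y : Fin k) a b → (x ↦ a) y +ℤ (x ↦ b) y ≡ (x ↦ a +ℤ b) y
↦-+ x y a b with ⌊ x ≟ y ⌋
... | true  = refl
... | false = refl

↦-zero : ∀ {k} (x y : Fin k) → (x ↦ 0ℤ) y ≡ 0ℤ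
↦-zero x y with ⌊ x ≟ y ⌋
... | true  = refl
... | false = refl

↦-nonneg : ∀ {k} (x y : Fin k) {a} → 0ℤ ≤ a → 0ℤ ≤ (x ↦ a) y
↦-nonneg x y 0≤a with ⌊ x ≟ y ⌋
... | true  = 0≤a
... | false = ℤ.≤-refl

↦-sgn-opposite : ∀ {k} (x y : Fin k) s → (x ↦ sgn (opposite s)) y +ℤ (x ↦ sgn s) y ≡ 0ℤ
↦-sgn-opposite x y s = begin
  (x ↦ sgn (opposite s)) y +ℤ (x ↦ sgn s) y ≡⟨ ↦-+ x y (sgn (opposite s)) (sgn s) ⟩
  (x ↦ sgn (opposite s) +ℤ sgn s) y          ≡⟨ cong (λ a → (x ↦ a) y) (sgn-opposite+sgn≡0 s) ⟩
  (x ↦ 0ℤ) y                                 ≡⟨ ↦-zero x y ⟩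
  0ℤ                                         ∎

Bool-sum-from : ∀ b (h : Bool → ℤ) → h false +ℤ h true ≡ h b +ℤ h (not b)
Bool-sum-from false h = refl
Bool-sum-from true  h = ℤ.+-comm (h false) (h true)

-- Flows of directed walks

weight : ∀ {m} → EndFun m → DStep m → ℤ
weight ω s = sgn (ω (edge s) (entry s) *ˢ ωin s)

-- fW ω W is definitionally the sum of stepFlow ω s over the steps s of W.
stepFlow : ∀ {m} → EndFun m → DStep m → Fin m → ℤ
stepFlow ω s = edge s ↦ weight ω s

module _ {n m : ℕ} (G : SignedGraph n m) (ω : EndFun m) where

  endContrib-zero : ∀ f v e b → f e ≡ 0ℤ → endContrib G ω f v e b ≡ 0ℤ
  endContrib-zero f v e b fe≡0 = trans (cong (λ z → (endpt G e b ↦ sgn (ω e b) * z) v) fe≡0)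
                                       (trans (cong (λ z → (endpt G e b ↦ z) v) (ℤ.*-zeroʳ (sgn (ω e b))))
                                              (↦-zero (endpt G e b) v))

  endContrib-+ : ∀ f g v e b → endContrib G ω (λ x → f x +ℤ g x) v e b
                               ≡ endContrib G ω f v e b +ℤ endContrib G ω g v e b
  endContrib-+ f g v e b =
    trans (cong (λ z → (endpt G e b ↦ z) v) (ℤ.*-distribˡ-+ (sgn (ω e b)) (f e) (g e)))
          (sym (↦-+ (endpt G e b) v _ _))

  edgeNetFlow : (Fin m → ℤ) → Fin n → Fin m → ℤ
  edgeNetFlow f v e = endContrib G ω f v e false +ℤ endContrib G ω f v e true

  netFlow-zero : ∀ v → netFlow G ω (λ _ → 0ℤ) v ≡ 0ℤ
  netFlow-zero v = sumℤ-map-zero _ (allFin m)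
    (λ e → cong₂ _+ℤ_ (endContrib-zero _ v e false refl) (endContrib-zero _ v e true refl))

  netFlow-+ : ∀ f g v → netFlow G ω (λ x → f x +ℤ g x) v ≡ netFlow G ω f v +ℤ netFlow G ω g v
  netFlow-+ f g v = trans (cong sumℤ (map-cong edgewise (allFin m)))
                          (sumℤ-map-+ (edgeNetFlow f v) (edgeNetFlow g v) (allFin m))
    where
    edgewise : ∀ e → edgeNetFlow (λ x → f x +ℤ g x) v e ≡ edgeNetFlow f v e +ℤ edgeNetFlow g v e
    edgewise e = trans (cong₂ _+ℤ_ (endContrib-+ f g v e false) (endContrib-+ f g v e true))
                           (ℤᶜ.interchange (endContrib G ω f v e false) (endContrib G ω g v e false)
                                           (endContrib G ω f v e true) (endContrib G ω g v e true))

  netFlow-sumℤ : ∀ {A : Set} (g : A → Fin m → ℤ) xs v →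
                 netFlow G ω (λ e → sumℤ (map (λ x → g x e) xs)) v
                   ≡ sumℤ (map (λ x → netFlow G ω (g x) v) xs)
  netFlow-sumℤ g []       v = netFlow-zero v
  netFlow-sumℤ g (x ∷ xs) v =
    trans (netFlow-+ (g x) _ v) (cong (netFlow G ω (g x) v +ℤ_) (netFlow-sumℤ g xs v))

  netFlow-single : ∀ f e v → (∀ e' → e' ≢ e → f e' ≡ 0ℤ) → netFlow G ω f v ≡ edgeNetFlow f v e
  netFlow-single f e v f≡0 = sumℤ-allFin-single (edgeNetFlow f v) e
    (λ e' e'≢e → cong₂ _+ℤ_ (endContrib-zero f v e' false (f≡0 e' e'≢e))
                            (endContrib-zero f v e' true (f≡0 e' e'≢e)))

  entryVertex exitVertex : DStep m → Fin n
  entryVertex s = endpt G (edge s) (entry s)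
  exitVertex  s = endpt G (edge s) (not (entry s))

  stepBoundary : DStep m → Fin n → ℤ
  stepBoundary s v = (entryVertex s ↦ sgn (ωin s)) v +ℤ (exitVertex s ↦ sgn (ωout s)) v

  -- Both ω and the direction of s orient the same edge, so [ω, ω_W] computed at
  -- either end is the same; hence ω · [ω, ω_W] is the direction of s at each end.
  netFlow-stepFlow : IsOrientation G ω → ∀ s v → σ G (edge s) ≡ opposite (ωin s *ˢ ωout s) →
                     netFlow G ω (stepFlow ω s) v ≡ stepBoundary s v
  netFlow-stepFlow orient s v σ≡-[wi*wo] = begin
    netFlow G ω (stepFlow ω s) v
      ≡⟨ netFlow-single (stepFlow ω s) e v (λ e' e'≢e → ↦-other _ (e'≢e ∘ sym)) ⟩
    atEnd false +ℤ atEnd true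
      ≡⟨ Bool-sum-from b atEnd ⟩
    atEnd b +ℤ atEnd (not b)
      ≡⟨ cong₂ _+ℤ_ (atEnd≡ b (s*[s*t]≡t (ω e b) wi))
                    (atEnd≡ (not b) (a*b≡c*d⇒b*[a*c]≡d {a = ω e b} {c = wi} (ω-agrees b))) ⟩
    stepBoundary s v ∎
    where
    e = edge s
    b = entry s
    wi = ωin s
    wo = ωout s

    atEnd : Bool → ℤ
    atEnd = endContrib G ω (stepFlow ω s) v e

    atEnd≡ : ∀ {w} b' → ω e b' *ˢ (ω e b *ˢ wi) ≡ w → atEnd b' ≡ (endpt G e b' ↦ sgn w) v
    atEnd≡ {w} b' eq = cong (λ a → (endpt G e b' ↦ a) v) (begin
      sgn (ω e b') * stepFlow ω s e     ≡⟨ cong (sgn (ω e b') *_) (↦-same e (weight ω s)) ⟩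
      sgn (ω e b') * sgn (ω e b *ˢ wi)  ≡⟨ sgn-* (ω e b') (ω e b *ˢ wi) ⟨
      sgn (ω e b' *ˢ (ω e b *ˢ wi))     ≡⟨ cong sgn eq ⟩
      sgn w                             ∎)

    ω-agrees : ∀ b → ω e b *ˢ ω e (not b) ≡ wi *ˢ wo
    ω-agrees false = Sign.opposite-injective (trans (sym (orient e)) σ≡-[wi*wo])
    ω-agrees true  = trans (Sign.*-comm (ω e true) (ω e false)) (ω-agrees false)

  stepBoundaries-telescope : ∀ {u} s ss → IsDWalkFrom G u (s ∷ ss) → ∀ v →
    sumℤ (map (λ t → stepBoundary t v) (s ∷ ss))
      ≡ (u ↦ sgn (ωin s)) v +ℤ (finishFrom G u (s ∷ ss) ↦ sgn (ωout (lastStep G s ss))) v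
  stepBoundaries-telescope s []        (refl , _) v = ℤ.+-identityʳ (stepBoundary s v)
  stepBoundaries-telescope s (s' ∷ ss) (refl , _ , coherent , walk) v = begin
    stepBoundary s v +ℤ sumℤ (map (λ t → stepBoundary t v) (s' ∷ ss))
      ≡⟨ cong (stepBoundary s v +ℤ_) (stepBoundaries-telescope s' ss walk v) ⟩
    (A +ℤ B) +ℤ (C +ℤ E) ≡⟨ ℤ.+-assoc A B (C +ℤ E) ⟩
    A +ℤ (B +ℤ (C +ℤ E)) ≡⟨ cong (A +ℤ_) (ℤ.+-assoc B C E) ⟨
    A +ℤ ((B +ℤ C) +ℤ E) ≡⟨ cong (λ z → A +ℤ (z +ℤ E)) B+C≡0 ⟩
    A +ℤ (0ℤ +ℤ E)       ≡⟨ cong (A +ℤ_) (ℤ.+-identityˡ E) ⟩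
    A +ℤ E               ∎
    where
    x = exitVertex s
    A = (entryVertex s ↦ sgn (ωin s)) v
    B = (x ↦ sgn (ωout s)) v
    C = (x ↦ sgn (ωin s')) v
    E = (finishFrom G x (s' ∷ ss) ↦ sgn (ωout (lastStep G s' ss))) v

    B+C≡0 : B +ℤ C ≡ 0ℤ
    B+C≡0 = trans (cong (λ w → (x ↦ sgn w) v +ℤ C) coherent) (↦-sgn-opposite x v (ωin s'))

  steps-oriented : ∀ {u ss} → IsDWalkFrom G u ss →
                   All (λ t → σ G (edge t) ≡ opposite (ωin t *ˢ ωout t)) ss
  steps-oriented {ss = []}     _                = []
  steps-oriented {ss = _ ∷ _} (_ , σ≡ , _ , walk) = σ≡ ∷ steps-oriented walk

  fW-isFlow : IsOrientation G ω → ∀ W → IsDirectedClosedWalk G W → IsFlow G ω (fW ω W)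
  fW-isFlow orient (dwalk u [])       _                        v = netFlow-zero v
  fW-isFlow orient (dwalk u (s ∷ ss)) (walk , closed , coherent) v = begin
    netFlow G ω (fW ω (dwalk u (s ∷ ss))) v
      ≡⟨ netFlow-sumℤ (stepFlow ω) (s ∷ ss) v ⟩
    sumℤ (map (λ t → netFlow G ω (stepFlow ω t) v) (s ∷ ss))
      ≡⟨ cong sumℤ (map-cong-local (All.map (λ {t} → netFlow-stepFlow orient t v) (steps-oriented walk))) ⟩
    sumℤ (map (λ t → stepBoundary t v) (s ∷ ss))
      ≡⟨ stepBoundaries-telescope s ss walk v ⟩
    (u ↦ sgn (ωin s)) v +ℤ (finishFrom G u (s ∷ ss) ↦ sgn (ωout (lastStep G s ss))) v
      ≡⟨ cong₂ (λ x w → (u ↦ sgn (ωin s)) v +ℤ (x ↦ sgn w) v) closed coherent ⟩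
    (u ↦ sgn (ωin s)) v +ℤ (u ↦ sgn (opposite (ωin s))) v
      ≡⟨ ℤ.+-comm ((u ↦ sgn (ωin s)) v) _ ⟩
    (u ↦ sgn (opposite (ωin s))) v +ℤ (u ↦ sgn (ωin s)) v
      ≡⟨ ↦-sgn-opposite u v (ωin s) ⟩
    0ℤ ∎

-- Lifting to the double cover

unliftE-liftE : ∀ {m} (e : Fin m) β → unliftE (liftE e β) ≡ (e , β)
unliftE-liftE {m} e + rewrite splitAt-↑ˡ m e m = refl
unliftE-liftE {m} e - rewrite splitAt-↑ʳ m m e = refl

liftE-injective : ∀ {m} {e e' : Fin m} β β' → liftE e β ≡ liftE e' β' → e ≡ e' × β ≡ β'
liftE-injective {e = e} {e'} β β' eq = ,-injective (begin
  (e , β)                ≡⟨ unliftE-liftE e β ⟨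
  unliftE (liftE e β)    ≡⟨ cong unliftE eq ⟩
  unliftE (liftE e' β')  ≡⟨ unliftE-liftE e' β' ⟩
  (e' , β')              ∎)

liftE-sheets-differ : ∀ {m} (e : Fin m) → liftE e + ≢ liftE e -
liftE-sheets-differ e = (λ ()) ∘ proj₂ ∘ liftE-injective + -

π-↦-liftE : ∀ {m} (e' : Fin m) β a e → π (liftE e' β ↦ a) e ≡ (e' ↦ a) e
π-↦-liftE e' β a e with e' ≟ e
... | no e'≢e = cong₂ _+ℤ_ (↦-other a (distinct +)) (↦-other a (distinct -))
  where
  distinct : ∀ γ → liftE e' β ≢ liftE e γ
  distinct γ = e'≢e ∘ proj₁ ∘ liftE-injective β γ
π-↦-liftE e + a .e | yes refl =
  trans (cong₂ _+ℤ_ (↦-same (liftE e +) a) (↦-other a (liftE-sheets-differ e)))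
        (ℤ.+-identityʳ a)
π-↦-liftE e - a .e | yes refl =
  trans (cong₂ _+ℤ_ (↦-other a (liftE-sheets-differ e ∘ sym)) (↦-same (liftE e -) a))
        (ℤ.+-identityˡ a)

π-sumℤ : ∀ {m} {A : Set} (g : A → Fin (m +ℕ m) → ℤ) xs e →
         π (λ x → sumℤ (map (λ t → g t x) xs)) e ≡ sumℤ (map (λ t → π (g t) e) xs)
π-sumℤ {m} g xs e = sym (sumℤ-map-+ (λ t → g t (e ↑ˡ m)) (λ t → g t (m ↑ʳ e)) xs)

module _ {n m : ℕ} (G : SignedGraph n m) where

  private
    G̃ = doubleCover G

  liftStep : Sign → DStep m → DStep (m +ℕ m)
  liftStep α s = dstep (liftE (edge s) (α *ˢ endShift G (edge s) (entry s))) (entry s)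
                       (α *ˢ ωin s) ((α *ˢ σ G (edge s)) *ˢ ωout s)

  map-liftSteps : ∀ {A : Set} {g : DStep (m +ℕ m) → A} {h : DStep m → A} →
                  (∀ α s → g (liftStep α s) ≡ h s) → ∀ α ss → map g (liftSteps G α ss) ≡ map h ss
  map-liftSteps g∘lift≡h α []       = refl
  map-liftSteps g∘lift≡h α (s ∷ ss) = cong₂ _∷_ (g∘lift≡h α s) (map-liftSteps g∘lift≡h _ ss)

  All-liftSteps : ∀ {P : DStep m → Set} {Q : DStep (m +ℕ m) → Set} →
                  (∀ α {s} → P s → Q (liftStep α s)) → ∀ α {ss} → All P ss → All Q (liftSteps G α ss)
  All-liftSteps P⇒Q α []       = []
  All-liftSteps P⇒Q α (p ∷ ps) = P⇒Q α p ∷ All-liftSteps P⇒Q _ ps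

  endpt-liftE : ∀ e β b → endpt G̃ (liftE e β) b ≡ liftV (endpt G e b) (β *ˢ endShift G e b)
  endpt-liftE e β b rewrite unliftE-liftE e β = refl

  liftOrientation-liftE : ∀ ω e β b → liftOrientation G ω (liftE e β) b ≡ (β *ˢ endShift G e b) *ˢ ω e b
  liftOrientation-liftE ω e β b rewrite unliftE-liftE e β = refl

  liftOrientation-isOrientation : ∀ ω → IsOrientation G ω → IsOrientation G̃ (liftOrientation G ω)
  liftOrientation-isOrientation ω orient x =
    subst (λ s → + ≡ opposite ((s *ˢ ω e false) *ˢ ((β *ˢ σ G e) *ˢ ω e true)))
          (sym (Sign.*-identityʳ β))
          (lifted-orientation-positive β (orient e))
    where
    e = proj₁ (unliftE {m} x)
    β = proj₂ (unliftE {m} x)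

  endShift-across : ∀ α e b → (α *ˢ endShift G e b) *ˢ endShift G e (not b) ≡ α *ˢ σ G e
  endShift-across α e false = cong (_*ˢ σ G e) (Sign.*-identityʳ α)
  endShift-across α e true  = Sign.*-identityʳ (α *ˢ σ G e)

  entry-liftStep : ∀ α s → endpt G̃ (edge (liftStep α s)) (entry s) ≡ liftV (endpt G (edge s) (entry s)) α
  entry-liftStep α s = trans (endpt-liftE (edge s) (α *ˢ shift) (entry s)) (cong (liftV _) ([s*t]*t≡s α shift))
    where shift = endShift G (edge s) (entry s)

  exit-liftStep : ∀ α s → endpt G̃ (edge (liftStep α s)) (not (entry s))
                          ≡ liftV (endpt G (edge s) (not (entry s))) (α *ˢ σ G (edge s))
  exit-liftStep α s = trans (endpt-liftE (edge s) (α *ˢ endShift G (edge s) (entry s)) (not (entry s)))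
                            (cong (liftV _) (endShift-across α (edge s) (entry s)))

  liftStep-coherent : ∀ α s ss → CoherentNext G s ss →
                      CoherentNext G̃ (liftStep α s) (liftSteps G (α *ˢ σ G (edge s)) ss)
  liftStep-coherent α s []       _          = tt
  liftStep-coherent α s (s' ∷ _) wo≡-wi' =
    trans (cong (α' *ˢ_) wo≡-wi') (s*opposite[t]≡opposite[s*t] α' (ωin s'))
    where α' = α *ˢ σ G (edge s)

  liftSteps-isDWalk : ∀ α {u} ss → IsDWalkFrom G u ss → IsDWalkFrom G̃ (liftV u α) (liftSteps G α ss)
  liftSteps-isDWalk α []       _ = tt
  liftSteps-isDWalk α (s ∷ ss) (entry≡u , σ≡ , coherent , walk) =
    trans (entry-liftStep α s) (cong (λ x → liftV x α) entry≡u) ,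
    lifted-orientation-positive α σ≡ ,
    liftStep-coherent α s ss coherent ,
    subst (λ x → IsDWalkFrom G̃ x (liftSteps G _ ss)) (sym (exit-liftStep α s))
          (liftSteps-isDWalk _ ss walk)

  stepsSign : List (DStep m) → Sign
  stepsSign = foldr (λ s acc → σ G (edge s) *ˢ acc) +

  finishFrom-liftSteps : ∀ α u ss →
    finishFrom G̃ (liftV u α) (liftSteps G α ss) ≡ liftV (finishFrom G u ss) (α *ˢ stepsSign ss)
  finishFrom-liftSteps α u []       = cong (liftV u) (sym (Sign.*-identityʳ α))
  finishFrom-liftSteps α u (s ∷ ss) = begin
    finishFrom G̃ (endpt G̃ (edge (liftStep α s)) (not (entry s))) (liftSteps G α' ss)
      ≡⟨ cong (λ x → finishFrom G̃ x (liftSteps G α' ss)) (exit-liftStep α s) ⟩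
    finishFrom G̃ (liftV x α') (liftSteps G α' ss)
      ≡⟨ finishFrom-liftSteps α' x ss ⟩
    liftV (finishFrom G x ss) (α' *ˢ stepsSign ss)
      ≡⟨ cong (liftV _) (Sign.*-assoc α (σ G (edge s)) (stepsSign ss)) ⟩
    liftV (finishFrom G x ss) (α *ˢ stepsSign (s ∷ ss)) ∎
    where
    α' = α *ˢ σ G (edge s)
    x  = endpt G (edge s) (not (entry s))

  lastExit-liftSteps : ∀ α s ss →
    ωout (lastStep G̃ (liftStep α s) (liftSteps G (α *ˢ σ G (edge s)) ss))
      ≡ (α *ˢ stepsSign (s ∷ ss)) *ˢ ωout (lastStep G s ss)
  lastExit-liftSteps α s []        =
    cong (λ t → (α *ˢ t) *ˢ ωout s) (sym (Sign.*-identityʳ (σ G (edge s))))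
  lastExit-liftSteps α s (s' ∷ ss) =
    trans (lastExit-liftSteps (α *ˢ σ G (edge s)) s' ss)
          (cong (_*ˢ ωout (lastStep G s' ss)) (Sign.*-assoc α (σ G (edge s)) (stepsSign (s' ∷ ss))))

  liftWalk-isDirectedClosedWalk : ∀ α {W} → IsDirectedClosedWalk G W → walkSign G W ≡ + →
                                  IsDirectedClosedWalk G̃ (liftWalk G α W)
  liftWalk-isDirectedClosedWalk α {dwalk u ss} (walk , closed , coherent) sign≡+ =
    liftSteps-isDWalk α ss walk ,
    trans (finishFrom-liftSteps α u ss) (cong₂ liftV closed α*sign≡α) ,
    liftedCoherentAtStart ss coherent sign≡+
    where
    α*sign≡α : α *ˢ stepsSign ss ≡ α
    α*sign≡α = trans (cong (α *ˢ_) sign≡+) (Sign.*-identityʳ α)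

    liftedCoherentAtStart : ∀ ss → CoherentAtStart G ss → stepsSign ss ≡ + →
                            CoherentAtStart G̃ (liftSteps G α ss)
    liftedCoherentAtStart []       _        _      = tt
    liftedCoherentAtStart (s ∷ ss) coherent sign≡+ = begin
      ωout (lastStep G̃ (liftStep α s) (liftSteps G (α *ˢ σ G (edge s)) ss))
        ≡⟨ lastExit-liftSteps α s ss ⟩
      (α *ˢ stepsSign (s ∷ ss)) *ˢ ωout (lastStep G s ss)
        ≡⟨ cong₂ (λ t w → (α *ˢ t) *ˢ w) sign≡+ coherent ⟩
      (α *ˢ +) *ˢ opposite (ωin s)
        ≡⟨ cong (_*ˢ opposite (ωin s)) (Sign.*-identityʳ α) ⟩
      α *ˢ opposite (ωin s)
        ≡⟨ s*opposite[t]≡opposite[s*t] α (ωin s) ⟩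
      opposite (α *ˢ ωin s) ∎

  weight-liftStep : ∀ ω α s → weight (liftOrientation G ω) (liftStep α s) ≡ weight ω s
  weight-liftStep ω α s = cong sgn (begin
    liftOrientation G ω (liftE e (α *ˢ shift)) b *ˢ (α *ˢ ωin s)
      ≡⟨ cong (_*ˢ (α *ˢ ωin s)) (liftOrientation-liftE ω e (α *ˢ shift) b) ⟩
    ((α *ˢ shift) *ˢ shift) *ˢ ω e b *ˢ (α *ˢ ωin s)
      ≡⟨ cong (λ t → t *ˢ ω e b *ˢ (α *ˢ ωin s)) ([s*t]*t≡s α shift) ⟩
    (α *ˢ ω e b) *ˢ (α *ˢ ωin s)
      ≡⟨ [s*a]*[s*b]≡a*b α (ω e b) (ωin s) ⟩
    ω e b *ˢ ωin s ∎)
    where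
    e = edge s
    b = entry s
    shift = endShift G e b

  π-fW-liftWalk : ∀ ω α W e → π (fW (liftOrientation G ω) (liftWalk G α W)) e ≡ fW ω W e
  π-fW-liftWalk ω α W e = begin
    π (fW ω̃ (liftWalk G α W)) e
      ≡⟨ π-sumℤ (stepFlow ω̃) (liftSteps G α (steps W)) e ⟩
    sumℤ (map (λ t → π (stepFlow ω̃ t) e) (liftSteps G α (steps W)))
      ≡⟨ cong sumℤ (map-liftSteps π-stepFlow-liftStep α (steps W)) ⟩
    fW ω W e ∎
    where
    ω̃ = liftOrientation G ω

    π-stepFlow-liftStep : ∀ α s → π (stepFlow ω̃ (liftStep α s)) e ≡ stepFlow ω s e
    π-stepFlow-liftStep α s =
      trans (cong (λ a → π (edge (liftStep α s) ↦ a) e) (weight-liftStep ω α s))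
            (π-↦-liftE (edge s) (α *ˢ endShift G (edge s) (entry s)) (weight ω s) e)

  fW-liftWalk-nonneg : ∀ ω α W → All (λ s → ωin s ≡ ω (edge s) (entry s)) (steps W) →
                       ∀ x → 0ℤ ≤ fW (liftOrientation G ω) (liftWalk G α W) x
  fW-liftWalk-nonneg ω α W directedByω x = sumℤ-map-nonneg (All-liftSteps liftedStep-nonneg α directedByω)
    where
    liftedStep-nonneg : ∀ α {s} → ωin s ≡ ω (edge s) (entry s) →
                        0ℤ ≤ stepFlow (liftOrientation G ω) (liftStep α s) x
    liftedStep-nonneg α {s} wi≡ω = ↦-nonneg _ x (subst (0ℤ ≤_) (sym weight≡1) (+≤+ z≤n))
      where
      weight≡1 : weight (liftOrientation G ω) (liftStep α s) ≡ 1ℤ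
      weight≡1 = trans (weight-liftStep ω α s)
                       (trans (cong (λ w → sgn (ω (edge s) (entry s) *ˢ w)) wi≡ω)
                              (cong sgn (Sign.s*s≡+ (ω (edge s) (entry s)))))

ωOf-nonneg : ∀ {m} (ω : EndFun m) (f : Fin m → ℤ) e b → 0ℤ ≤ f e → ωOf ω f e b ≡ ω e b
ωOf-nonneg ω f e b 0≤fe with f e
ωOf-nonneg ω f e b 0≤fe | ℤ.pos _    = refl
ωOf-nonneg ω f e b ()   | ℤ.negsuc _

direction-at-entries : ∀ {n m} {ω' : EndFun m} {u : Fin n} ss → DirectionIs (dwalk u ss) ω' →
                       All (λ s → ωin s ≡ ω' (edge s) (entry s)) ss
direction-at-entries         []       _               = []
direction-at-entries {u = u} (s ∷ ss) (wi≡ , _ , dir) = wi≡ ∷ direction-at-entries {u = u} ss dir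

proposition3p5 :
    (∀ {n m} (G : SignedGraph n m) (ω : EndFun m) (W : DWalk n m) (α : Sign)
       → IsOrientation G ω
       → IsDirectedClosedWalk G W
       → walkSign G W ≡ +
       → IsDirectedClosedWalk (doubleCover G) (liftWalk G α W)
         × (∀ e → π (fW (liftOrientation G ω) (liftWalk G α W)) e ≡ fW ω W e))
    ×
    (∀ {n m} (G : SignedGraph n m) (ω : EndFun m) (f : Fin m → ℤ)
       (W : DWalk n m) (α : Sign)
       → IsOrientation G ω
       → IsFlow G ω f
       → IsDirectedClosedWalk G W
       → DirectionIs W (ωOf ω f)
       → walkSign G W ≡ +
       → (∀ e → f e ≡ fW ω W e)
       → IsDirectedClosedWalk (doubleCover G) (liftWalk G α W)
       → (IsFlow (doubleCover G) (liftOrientation G ω)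
            (fW (liftOrientation G ω) (liftWalk G α W))
          × (∀ e → π (fW (liftOrientation G ω) (liftWalk G α W)) e ≡ f e))
         × ((∀ e → 0ℤ ≤ f e)
            → ∀ x → 0ℤ ≤ fW (liftOrientation G ω) (liftWalk G α W) x))
proposition3p5 =
  (λ G ω W α _ closed positive →
     liftWalk-isDirectedClosedWalk G α closed positive , π-fW-liftWalk G ω α W) ,
  (λ G ω f W α orient _ _ directedByωf _ f≡fW liftClosed →
     ( fW-isFlow (doubleCover G) (liftOrientation G ω) (liftOrientation-isOrientation G ω orient)
                 (liftWalk G α W) liftClosed
     , λ e → trans (π-fW-liftWalk G ω α W e) (sym (f≡fW e)) )
     , λ f≥0 → fW-liftWalk-nonneg G ω α W
                 (All.map (λ {s} wi≡ωf → trans wi≡ωf (ωOf-nonneg ω f (edge s) (entry s) (f≥0 (edge s))))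
                          (direction-at-entries {u = start W} (steps W) directedByωf)))
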